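{- For a given $k$-partition $\hat P=\{P_1,\dots,P_k\}$ of the vertices of the path $x_0,\dots,x_n$, the number of scenarios $s$ for which there is an index $d$ with (1) $w_i(s)=w_i^-$ for all $x_i\notin P_d$ and (2) the sub-scenario of $s$ within $P_d$ left-dominant or right-dominant, is $O(n)$. Consequently the adversary's worst-case scenario (of the form in which it exists for this partition) is chosen among $O(n)$ candidates.
   Context: Vertices $x_0<\dots<x_n$ of a path carry weight intervals $[w_i^-,w_i^+]$; a scenario $s$ assigns $w_i(s)\in[w_i^-,w_i^+]$. A $k$-partition divides the vertices into $k$ subpaths of consecutive vertices. A sub-scenario on a subpath $\{x_l,\dots,x_r\}$ is left-dominant (resp. right-dominant) if for some $l\le i\le r$, $w_j(s)=w_j^+$ (resp. $w_j^-$) for $l\le j<i$ and $w_j(s)=w_j^-$ (resp. $w_j^+$) for $i\le j\le r$. -}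

module Defs where

open import Data.Nat using (ℕ; zero; suc; _≤_; _<_; _*_)
open import Data.Fin using (Fin; toℕ; inject₁; fromℕ)
open import Data.Rational using (ℚ) renaming (_≤_ to _≤ℚ_)
open import Data.Product using (Σ; _×_; ∃; ∃-syntax)
open import Data.Sum using (_⊎_)
open import Data.List using (List; length)
open import Data.List.Relation.Unary.Any using (Any)
open import Relation.Nullary using (¬_)
open import Relation.Binary.PropositionalEquality using (_≡_)

Weights : ℕ → Set
Weights n = Fin (suc n) → ℚ

IsScenario : ∀ {n} → (wmin wmax s : Weights n) → Set
IsScenario {n} wmin wmax s = ∀ (i : Fin (suc n)) → (wmin i ≤ℚ s i) × (s i ≤ℚ wmax i)

-- A k-partition of x_0..x_n into k nonempty subpaths of consecutive
-- vertices, given by cut points 0 = cut 0 < cut 1 < ... < cut k = n+1;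
-- part P_d (d : Fin k) is {x_j | cut d ≤ j < cut (d+1)}.
record KPartition (n k : ℕ) : Set where
  field
    cut       : Fin (suc k) → ℕ
    cut-first : cut Fin.zero ≡ 0
    cut-last  : cut (fromℕ k) ≡ suc n
    cut-mono  : ∀ (d : Fin k) → cut (inject₁ d) < cut (Fin.suc d)
open KPartition public

lo : ∀ {n k} → KPartition n k → Fin k → ℕ
lo P d = cut P (inject₁ d)

hi : ∀ {n k} → KPartition n k → Fin k → ℕ
hi P d = cut P (Fin.suc d)

InPart : ∀ {n k} → KPartition n k → Fin k → Fin (suc n) → Set
InPart P d j = (lo P d ≤ toℕ j) × (toℕ j < hi P d)

LeftDominant : ∀ {n k} → KPartition n k → (wmin wmax s : Weights n) → Fin k → Set
LeftDominant P wmin wmax s d =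
  ∃[ i ] ((lo P d ≤ i) × (i < hi P d) ×
    (∀ j → InPart P d j →
        (toℕ j < i → s j ≡ wmax j) × (i ≤ toℕ j → s j ≡ wmin j)))

RightDominant : ∀ {n k} → KPartition n k → (wmin wmax s : Weights n) → Fin k → Set
RightDominant P wmin wmax s d =
  ∃[ i ] ((lo P d ≤ i) × (i < hi P d) ×
    (∀ j → InPart P d j →
        (toℕ j < i → s j ≡ wmin j) × (i ≤ toℕ j → s j ≡ wmax j)))

Special : ∀ {n k} → KPartition n k → (wmin wmax s : Weights n) → Set
Special {n} {k} P wmin wmax s =
  ∃[ d ] ((∀ j → ¬ InPart P d j → s j ≡ wmin j) ×
          (LeftDominant P wmin wmax s d ⊎ RightDominant P wmin wmax s d))

SameScenario : ∀ {n} → Weights n → Weights n → Set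
SameScenario {n} s t = ∀ (j : Fin (suc n)) → s j ≡ t j

-- A special scenario is determined by its part d, its switch index i and its
-- orientation: it is w⁺ exactly on the vertices of P_d before i (left-dominant)
-- or from i on (right-dominant), and w⁻ elsewhere. The vertices of P_d are
-- those that no cut point separates from i, so the scenario depends on i and
-- the orientation alone, leaving at most 2(n+1) candidates.
module Submission where

open import Defs
open import Data.Nat using (ℕ; suc; _≤_; _*_)
open import Data.Rational using () renaming (_≤_ to _≤ℚ_)
open import Data.Fin using (Fin)
open import Data.Product using (∃-syntax; _×_)
open import Data.List using (List; length)
open import Data.List.Relation.Unary.Any using (Any)

open import Data.Bool using (if_then_else_)
open import Data.Nat using (_<_; _+_; z≤n; s≤s; _<?_; _≤?_)
open import Data.Nat.Properties
open import Data.Fin as Fin using (toℕ; inject₁; fromℕ)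
open import Data.Fin.Properties using (any?; toℕ-inject₁; ≤fromℕ)
open import Data.Product using (_,_; proj₁; proj₂; ∃)
open import Data.Sum using (inj₁; inj₂)
open import Data.List using (applyUpTo; _++_)
open import Data.List.Properties using (length-++; length-applyUpTo)
open import Data.List.Relation.Unary.Any.Properties using (applyUpTo⁺; ++⁺ˡ; ++⁺ʳ)
open import Relation.Nullary using (Dec; yes; no; does; ¬_; ¬?; _×-dec_)
open import Relation.Binary.PropositionalEquality
  using (_≡_; sym; cong; cong₂; subst; module ≡-Reasoning)

≡-if-does : ∀ {A X : Set} {x a b : A} (X? : Dec X) →
            (X → x ≡ a) → (¬ X → x ≡ b) → x ≡ (if does X? then a else b)
≡-if-does (yes p) x≡a _ = x≡a p
≡-if-does (no ¬p) _ x≡b = x≡b ¬p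

stepwise-monotone : ∀ {k} (f : Fin (suc k) → ℕ) → (∀ d → f (inject₁ d) ≤ f (Fin.suc d)) →
                    ∀ {a b} → toℕ a ≤ toℕ b → f a ≤ f b
stepwise-monotone f step {Fin.zero} {Fin.zero} _ = ≤-refl
stepwise-monotone {suc k} f step {Fin.zero} {Fin.suc b} _ =
  ≤-trans (step Fin.zero) (stepwise-monotone (λ x → f (Fin.suc x)) (λ d → step (Fin.suc d)) {b = b} z≤n)
stepwise-monotone {suc k} f step {Fin.suc a} {Fin.suc b} (s≤s a≤b) =
  stepwise-monotone (λ x → f (Fin.suc x)) (λ d → step (Fin.suc d)) a≤b

module _ {n k : ℕ} (P : KPartition n k) where

  cut-monotone : ∀ {a b} → toℕ a ≤ toℕ b → cut P a ≤ cut P b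
  cut-monotone = stepwise-monotone (cut P) (λ d → <⇒≤ (cut-mono P d))

  hi≤suc-n : ∀ d → hi P d ≤ suc n
  hi≤suc-n d = subst (hi P d ≤_) (cut-last P) (cut-monotone (≤fromℕ (Fin.suc d)))

  inPart? : ∀ d j → Dec (InPart P d j)
  inPart? d j = (lo P d ≤? toℕ j) ×-dec (toℕ j <? hi P d)

  Separated : ℕ → ℕ → Set
  Separated a b = ∃ λ m → (a < cut P m) × (cut P m ≤ b)

  separated? : ∀ a b → Dec (Separated a b)
  separated? a b = any? (λ m → (a <? cut P m) ×-dec (cut P m ≤? b))

  ¬separated-within : ∀ d {a b} → lo P d ≤ a → b < hi P d → ¬ Separated a b
  ¬separated-within d lo≤a b<hi (m , a<m , m≤b) with toℕ m ≤? toℕ d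
  ... | yes m≤d = <⇒≱ (≤-<-trans lo≤a a<m)
                      (cut-monotone (subst (toℕ m ≤_) (sym (toℕ-inject₁ d)) m≤d))
  ... | no m≰d  = <⇒≱ (≤-<-trans m≤b b<hi) (cut-monotone (≰⇒> m≰d))

  module _ (wmin wmax : Weights n) where

    LeftHeavy RightHeavy : ℕ → Fin (suc n) → Set
    LeftHeavy  i j = (toℕ j < i) × ¬ Separated (toℕ j) i
    RightHeavy i j = (i ≤ toℕ j) × ¬ Separated i (toℕ j)

    leftCandidate rightCandidate : ℕ → Weights n
    leftCandidate i j =
      if does ((toℕ j <? i) ×-dec ¬? (separated? (toℕ j) i)) then wmax j else wmin j
    rightCandidate i j =
      if does ((i ≤? toℕ j) ×-dec ¬? (separated? i (toℕ j))) then wmax j else wmin j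

    candidates : List (Weights n)
    candidates = applyUpTo leftCandidate (suc n) ++ applyUpTo rightCandidate (suc n)

    length-candidates : length candidates ≡ 2 * suc n
    length-candidates = begin
      length candidates
        ≡⟨ length-++ (applyUpTo leftCandidate (suc n)) ⟩
      length (applyUpTo leftCandidate (suc n)) + length (applyUpTo rightCandidate (suc n))
        ≡⟨ cong₂ _+_ (length-applyUpTo leftCandidate (suc n)) (length-applyUpTo rightCandidate (suc n)) ⟩
      suc n + suc n
        ≡⟨ cong (suc n +_) (sym (+-identityʳ (suc n))) ⟩
      2 * suc n ∎
      where open ≡-Reasoning

    module _ {s : Weights n} {d : Fin k} (outside : ∀ j → ¬ InPart P d j → s j ≡ wmin j) where

      leftDominant⇒leftCandidate : (ld : LeftDominant P wmin wmax s d) →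
                                   SameScenario s (leftCandidate (proj₁ ld))
      leftDominant⇒leftCandidate (i , lo≤i , i<hi , dom) j =
        ≡-if-does ((toℕ j <? i) ×-dec ¬? (separated? (toℕ j) i)) heavy light
        where
        heavy : LeftHeavy i j → s j ≡ wmax j
        heavy (j<i , ¬sep) = proj₁ (dom j (lo≤j , <-trans j<i i<hi)) j<i
          where lo≤j = ≮⇒≥ (λ j<lo → ¬sep (inject₁ d , j<lo , lo≤i))
        light : ¬ LeftHeavy i j → s j ≡ wmin j
        light ¬heavy with inPart? d j
        ... | no j∉P = outside j j∉P
        ... | yes j∈P@(lo≤j , _) =
          proj₂ (dom j j∈P) (≮⇒≥ (λ j<i → ¬heavy (j<i , ¬separated-within d lo≤j i<hi)))

      rightDominant⇒rightCandidate : (rd : RightDominant P wmin wmax s d) →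
                                     SameScenario s (rightCandidate (proj₁ rd))
      rightDominant⇒rightCandidate (i , lo≤i , i<hi , dom) j =
        ≡-if-does ((i ≤? toℕ j) ×-dec ¬? (separated? i (toℕ j))) heavy light
        where
        heavy : RightHeavy i j → s j ≡ wmax j
        heavy (i≤j , ¬sep) = proj₂ (dom j (≤-trans lo≤i i≤j , j<hi)) i≤j
          where j<hi = ≰⇒> (λ hi≤j → ¬sep (Fin.suc d , i<hi , hi≤j))
        light : ¬ RightHeavy i j → s j ≡ wmin j
        light ¬heavy with inPart? d j
        ... | no j∉P = outside j j∉P
        ... | yes j∈P@(_ , j<hi) =
          proj₁ (dom j j∈P) (≰⇒> (λ i≤j → ¬heavy (i≤j , ¬separated-within d lo≤i j<hi)))

    special⇒candidate : ∀ {s} → Special P wmin wmax s → Any (SameScenario s) candidates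
    special⇒candidate (d , outside , inj₁ ld@(_ , _ , i<hi , _)) =
      ++⁺ˡ (applyUpTo⁺ leftCandidate (leftDominant⇒leftCandidate outside ld)
                       (<-≤-trans i<hi (hi≤suc-n d)))
    special⇒candidate (d , outside , inj₂ rd@(_ , _ , i<hi , _)) =
      ++⁺ʳ (applyUpTo leftCandidate (suc n))
           (applyUpTo⁺ rightCandidate (rightDominant⇒rightCandidate outside rd)
                       (<-≤-trans i<hi (hi≤suc-n d)))

mainTheorem7 : ∃[ C ] (∀ (n k : ℕ) (P : KPartition n k) (wmin wmax : Weights n) →
    (∀ (i : Fin (suc n)) → wmin i ≤ℚ wmax i) →
    ∃[ L ] ((length L ≤ C * suc n) ×
    (∀ (s : Weights n) → IsScenario wmin wmax s →
    Special P wmin wmax s → Any (SameScenario s) L)))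
mainTheorem7 = 2 , λ n k P wmin wmax _ →
  candidates P wmin wmax ,
  ≤-reflexive (length-candidates P wmin wmax) ,
  λ s _ → special⇒candidate P wmin wmax
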